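{- Let $b\ge 2$ be an integer and let $k,r,y$ be nonnegative integers with $2y<r<k-1$. Write $\nu(k,r,y)-1=b^{e_0}+b^{e_1}+\cdots+b^{e_\ell}$ with nonnegative integers $e_0<e_1<\cdots<e_\ell=k$, and let $\lambda$ be the smallest nonnegative integer such that $e_{\ell-1-\lambda}\leq r-2\lambda-1$. Then $e_{\ell-1-\lambda}=r-2\lambda-1$.
   Context: Fix an integer $b\ge 2$. A base $b$ over-expansion of a positive integer $N$ is a word $d_kd_{k-1}\cdots d_0$ over $\{0,1,\ldots,b\}$ with $d_k\neq 0$ and $\sum_{i=0}^k d_ib^i=N$. For $n\ge 2$, $s_b(n)$ is the number of base $b$ over-expansions of $n-1$; $s_b(0)=0$, $s_b(1)=1$. For nonnegative integers $k,r,y$: $I(k,r,y)=\{n\in\mathbb N: b^k<n\le b^k+\sum_{i=0}^y b^{r-2i}\}$, $\mu(k,r,y)=\max\{s_b(n):n\in I(k,r,y)\}$, and $\nu(k,r,y)=\min\{n\in I(k,r,y): s_b(n)=\mu(k,r,y)\}$. (The ordinary base $b$ expansion of $\nu(k,r,y)-1$ has $k+1$ digits, all in $\{0,1\}$.) -}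

module Defs where

open import Data.Nat using (ℕ; zero; suc; _+_; _*_; _∸_; _^_; _≤_; _<_; _≡ᵇ_)
open import Data.Bool using (Bool; true; false; _∧_; not)
open import Data.List using (List; []; _∷_; map; concatMap; upTo; foldl; filterᵇ; length)
open import Data.Nat.ListAction using (sum)

-- All words of length m over the digit alphabet {0,1,…,b}.
-- A word is written most-significant digit first: d_k d_{k-1} ⋯ d_0.
words : ℕ → ℕ → List (List ℕ)
words b zero    = [] ∷ []
words b (suc m) = concatMap (λ d → map (d ∷_) (words b m)) (upTo (suc b))

value : ℕ → List ℕ → ℕ
value b = foldl (λ acc d → acc * b + d) 0

leadingNonzero : List ℕ → Bool
leadingNonzero []       = false
leadingNonzero (d ∷ _)  = not (d ≡ᵇ 0)

isOverExp : ℕ → ℕ → List ℕ → Bool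
isOverExp b N w = leadingNonzero w ∧ (value b w ≡ᵇ N)

-- all over-expansions of N (N ≥ 1, b ≥ 2): a word d_k⋯d_0 with d_k ≠ 0 has
-- b^k ≤ N, hence k < N, so its length k+1 is at most N; we enumerate all
-- words of length 1 … N+1 (each word appears exactly once).
overExpansions : ℕ → ℕ → List (List ℕ)
overExpansions b N = concatMap (λ m → filterᵇ (isOverExp b N) (words b (suc m))) (upTo (suc N))

s : ℕ → ℕ → ℕ
s b zero          = 0
s b (suc zero)    = 1
s b (suc (suc m)) = length (overExpansions b (suc m))

InI : ℕ → ℕ → ℕ → ℕ → ℕ → Set
InI b k r y n = (b ^ k < n) × (n ≤ b ^ k + sum (map (λ i → b ^ (r ∸ 2 * i)) (upTo (suc y))))
  where open import Data.Product using (_×_)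

IsNu : ℕ → ℕ → ℕ → ℕ → ℕ → Set
IsNu b k r y ν =
  InI b k r y ν
  × (∀ m → InI b k r y m → s b m ≤ s b ν)
  × (∀ m → InI b k r y m → m < ν → s b m < s b ν)
  where open import Data.Product using (_×_)

module Submission where

-- Suppose the inequality is strict and write r = n + 1 + 2λ. Split ν − 1 = H + t, where t collects
-- the powers b ^ e_i with i ≤ ℓ − 1 − λ. Then t has base-b digits 0 and 1 only, all below position n,
-- while the minimality of λ makes H a multiple of b ^ (n + 2) with b ^ k ≤ H and
-- H + b ^ (n + 1) ≤ max I, so the whole block H < m ≤ H + b ^ (n + 1) lies in I.
-- Reading over-expansions digit by digit gives, for T < b ^ (n + 1),
--   s_b(H + T + 1) = p · A(T) + q · A(b ^ (n + 1) + T),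
-- where A counts the words of length n + 1 over {0, …, b} of a given value, and p and q count the
-- over-expansions of Q = H / b ^ (n + 1) and of Q − 1; p > q because b divides Q. A Stern-type
-- exchange of the two counts attached to the 0/1 tail t then yields either a point of the block with
-- a larger value of s_b, or the earlier point H + 1 with a value at least s_b(ν); both contradict the
-- choice of ν.

open import Defs
open import Data.Nat using (ℕ; zero; suc; _+_; _*_; _∸_; _^_; _≤_; _<_; _≡ᵇ_; z≤n; s≤s; NonZero; >-nonZero)
open import Data.Nat.Properties
open import Data.Nat.DivMod using (_/_; _%_; m≡m%n+[m/n]*n; m%n<n; m<n*o⇒m/o<n)
open import Data.Bool using (Bool; true; false; T; if_then_else_)
open import Data.List using (List; []; _∷_; map; concatMap; upTo; applyUpTo; foldl; filterᵇ; length; _++_)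
open import Data.List.Properties using (length-++; map-applyUpTo; map-cong)
open import Data.Nat.ListAction using (sum)
open import Relation.Binary.PropositionalEquality
open import Relation.Nullary using (¬_; contradiction)
open import Data.Nat.Divisibility using (_∣_; divides; _∣0; ∣m∣n⇒∣m+n)
open import Relation.Binary.Definitions using (tri<; tri≈; tri>)
open import Data.Empty using (⊥)
open import Data.Sum using (_⊎_; inj₁; inj₂; [_,_]′)
open import Data.Product using (_×_; _,_; proj₁; proj₂; ∃-syntax)
open import Data.Nat.Tactic.RingSolver using (solve-∀)
open import Algebra.Properties.CommutativeSemigroup +-commutativeSemigroup
  using () renaming (interchange to +-interchange)

∑ : ℕ → (ℕ → ℕ) → ℕ
∑ zero    f = 0
∑ (suc n) f = f 0 + ∑ n (λ i → f (suc i))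

infix 7 ∑
syntax ∑ n (λ i → e) = ∑[ i < n ] e

sum-map-upTo : ∀ n f → sum (map f (upTo n)) ≡ ∑ n f
sum-map-upTo n f = trans (cong sum (map-applyUpTo (λ i → i) f n)) (go n f)
  where
  go : ∀ n f → sum (applyUpTo f n) ≡ ∑ n f
  go zero    f = refl
  go (suc n) f = cong (f 0 +_) (go n (λ i → f (suc i)))

∑-cong-< : ∀ n {f g} → (∀ i → i < n → f i ≡ g i) → ∑ n f ≡ ∑ n g
∑-cong-< zero    f≗g = refl
∑-cong-< (suc n) f≗g = cong₂ _+_ (f≗g 0 (s≤s z≤n)) (∑-cong-< n (λ i i<n → f≗g (suc i) (s≤s i<n)))

∑-cong : ∀ n {f g} → (∀ i → f i ≡ g i) → ∑ n f ≡ ∑ n g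
∑-cong n f≗g = ∑-cong-< n (λ i _ → f≗g i)

∑-zero : ∀ n → ∑[ i < n ] 0 ≡ 0
∑-zero zero    = refl
∑-zero (suc n) = ∑-zero n

∑-distrib-+ : ∀ n f g → ∑[ i < n ] (f i + g i) ≡ ∑ n f + ∑ n g
∑-distrib-+ zero    f g = refl
∑-distrib-+ (suc n) f g =
  trans (cong (f 0 + g 0 +_) (∑-distrib-+ n _ _)) (+-interchange (f 0) (g 0) _ _)

∑-distribˡ-* : ∀ n c f → ∑[ i < n ] (c * f i) ≡ c * ∑ n f
∑-distribˡ-* zero    c f = sym (*-zeroʳ c)
∑-distribˡ-* (suc n) c f = trans (cong (c * f 0 +_) (∑-distribˡ-* n c _)) (sym (*-distribˡ-+ c (f 0) _))

∑-++ : ∀ m n f → ∑ (m + n) f ≡ ∑ m f + ∑[ i < n ] f (m + i)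
∑-++ zero    n f = refl
∑-++ (suc m) n f = trans (cong (f 0 +_) (∑-++ m n (λ i → f (suc i)))) (sym (+-assoc (f 0) _ _))

∑-snoc : ∀ n f → ∑ (suc n) f ≡ ∑ n f + f n
∑-snoc zero    f = +-identityʳ (f 0)
∑-snoc (suc n) f = trans (cong (f 0 +_) (∑-snoc n _)) (sym (+-assoc (f 0) _ _))

∑-reverse : ∀ n f → ∑ n f ≡ ∑[ i < n ] f (n ∸ suc i)
∑-reverse zero    f = refl
∑-reverse (suc n) f = trans (∑-snoc n f) (trans (cong (_+ f n) (∑-reverse n f)) (+-comm _ (f n)))

∑-mono-≤ : ∀ n {f g} → (∀ i → i < n → f i ≤ g i) → ∑ n f ≤ ∑ n g
∑-mono-≤ zero    f≤g = z≤n
∑-mono-≤ (suc n) f≤g = +-mono-≤ (f≤g 0 (s≤s z≤n)) (∑-mono-≤ n (λ i i<n → f≤g (suc i) (s≤s i<n)))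

∑-≤-longer : ∀ {m m'} f → m ≤ m' → ∑ m f ≤ ∑ m' f
∑-≤-longer {m} {m'} f m≤m' = begin
  ∑ m f                                ≤⟨ m≤m+n (∑ m f) _ ⟩
  ∑ m f + ∑[ i < m' ∸ m ] f (m + i)    ≡⟨ ∑-++ m (m' ∸ m) f ⟨
  ∑ (m + (m' ∸ m)) f                   ≡⟨ cong (λ n → ∑ n f) (m+[n∸m]≡n m≤m') ⟩
  ∑ m' f                               ∎
  where open ≤-Reasoning

∑-∣ : ∀ n {d} f → (∀ i → i < n → d ∣ f i) → d ∣ ∑ n f
∑-∣ zero    f d∣f = _ ∣0
∑-∣ (suc n) f d∣f = ∣m∣n⇒∣m+n (d∣f 0 (s≤s z≤n)) (∑-∣ n (λ i → f (suc i)) (λ i i<n → d∣f (suc i) (s≤s i<n)))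

∑-split-reversed : ∀ λ' c f →
  ∑ (suc (suc (λ' + c))) f ≡ ∑ (suc c) f + (f (suc (λ' + c)) + ∑[ μ < λ' ] f (λ' + c ∸ μ))
∑-split-reversed λ' c f = begin
  ∑ (suc (suc (λ' + c))) f
    ≡⟨ cong (λ n → ∑ n f) (cong suc (trans (cong suc (+-comm λ' c)) (sym (+-suc c λ')))) ⟩
  ∑ (suc c + suc λ') f
    ≡⟨ ∑-++ (suc c) (suc λ') f ⟩
  ∑ (suc c) f + ∑[ i < suc λ' ] f (suc c + i)
    ≡⟨ cong (∑ (suc c) f +_) (∑-snoc λ' (λ i → f (suc c + i))) ⟩
  ∑ (suc c) f + (∑[ i < λ' ] f (suc c + i) + f (suc c + λ'))
    ≡⟨ cong (∑ (suc c) f +_) (+-comm _ (f (suc c + λ'))) ⟩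
  ∑ (suc c) f + (f (suc c + λ') + ∑[ i < λ' ] f (suc c + i))
    ≡⟨ cong₂ (λ u v → ∑ (suc c) f + (f u + v)) (cong suc (+-comm c λ')) (∑-reverse λ' (λ i → f (suc c + i))) ⟩
  ∑ (suc c) f + (f (suc (λ' + c)) + ∑[ μ < λ' ] f (suc c + (λ' ∸ suc μ)))
    ≡⟨ cong (λ v → ∑ (suc c) f + (f (suc (λ' + c)) + v)) (∑-cong-< λ' (λ μ μ<λ → cong f (index μ μ<λ))) ⟩
  ∑ (suc c) f + (f (suc (λ' + c)) + ∑[ μ < λ' ] f (λ' + c ∸ μ)) ∎
  where
  open ≡-Reasoning
  index : ∀ μ → μ < λ' → suc c + (λ' ∸ suc μ) ≡ λ' + c ∸ μ
  index μ μ<λ = begin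
    suc c + (λ' ∸ suc μ)  ≡⟨ +-∸-assoc (suc c) μ<λ ⟨
    suc c + λ' ∸ suc μ    ≡⟨ cong (_∸ suc μ) (cong suc (+-comm c λ')) ⟩
    λ' + c ∸ μ            ∎

∑-telescope : ∀ n (f a : ℕ → ℕ) → (∀ i → f i + a i ≡ a (suc i)) → ∑ n f + a 0 ≡ a n
∑-telescope zero    f a step = refl
∑-telescope (suc n) f a step = begin
  f 0 + F + a 0    ≡⟨ +-assoc (f 0) F (a 0) ⟩
  f 0 + (F + a 0)  ≡⟨ cong (f 0 +_) (+-comm F (a 0)) ⟩
  f 0 + (a 0 + F)  ≡⟨ +-assoc (f 0) (a 0) F ⟨
  f 0 + a 0 + F    ≡⟨ cong (_+ F) (step 0) ⟩
  a 1 + F          ≡⟨ +-comm (a 1) F ⟩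
  F + a 1          ≡⟨ ∑-telescope n (λ i → f (suc i)) (λ i → a (suc i)) (λ i → step (suc i)) ⟩
  a (suc n)        ∎
  where
  open ≡-Reasoning
  F = ∑[ i < n ] f (suc i)

δ : ℕ → ℕ → ℕ
δ x y = if x ≡ᵇ y then 1 else 0

δ-refl : ∀ x → δ x x ≡ 1
δ-refl zero    = refl
δ-refl (suc x) = δ-refl x

δ-≢ : ∀ {x y} → x ≢ y → δ x y ≡ 0
δ-≢ {x} {y} x≢y with x ≡ᵇ y in eq
... | true  = contradiction (≡ᵇ⇒≡ x y (subst T (sym eq) _)) x≢y
... | false = refl

δ-+ : ∀ a x y → δ (a + x) (a + y) ≡ δ x y
δ-+ zero    x y = refl
δ-+ (suc a) x y = δ-+ a x y

∑-δ-≤ : ∀ n v → v ≤ n → ∑[ d < suc n ] δ d v ≡ 1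
∑-δ-≤ n       zero    _         = cong suc (∑-zero n)
∑-δ-≤ (suc n) (suc v) (s≤s v≤n) = ∑-δ-≤ n v v≤n

∑-δ-> : ∀ n v → n < v → ∑[ d < suc n ] δ d v ≡ 0
∑-δ-> zero    (suc v) _         = refl
∑-δ-> (suc n) (suc v) (s≤s n<v) = ∑-δ-> n v n<v

quotient-<⇒< : ∀ {Q A P T} x → T < P → Q < A → Q * P + T < A * P + x
quotient-<⇒< {Q} {A} {P} {T} x T<P Q<A = begin-strict
  Q * P + T  <⟨ +-monoʳ-< (Q * P) T<P ⟩
  Q * P + P  ≡⟨ +-comm (Q * P) P ⟩
  suc Q * P  ≤⟨ *-monoˡ-≤ P Q<A ⟩
  A * P      ≤⟨ m≤m+n (A * P) x ⟩
  A * P + x  ∎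
  where open ≤-Reasoning

quotient-2+≤⇒< : ∀ {A Q P x} T → suc x < 2 * P → 2 + A ≤ Q → A * P + x < Q * P + T
quotient-2+≤⇒< {A} {Q} {P} {x} T x<2P 2+A≤Q = begin-strict
  A * P + x        <⟨ +-monoʳ-< (A * P) (<-trans (n<1+n x) x<2P) ⟩
  A * P + 2 * P    ≡⟨ regroup A P ⟩
  (2 + A) * P      ≤⟨ *-monoˡ-≤ P 2+A≤Q ⟩
  Q * P            ≤⟨ m≤m+n (Q * P) T ⟩
  Q * P + T        ∎
  where
  open ≤-Reasoning
  regroup : ∀ A P → A * P + 2 * P ≡ (2 + A) * P
  regroup = solve-∀

-- Writing u = A * P + x with x < 2P − 1, the equation u = Q * P + T (T < P) forces Q ∈ {A, A + 1}.
δ-split : ∀ A Q x T P → T < P → suc x < 2 * P →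
  δ (A * P + x) (Q * P + T) ≡ δ A Q * δ x T + δ (suc A) Q * δ x (P + T)
δ-split A Q x T P T<P x<2P with <-cmp A Q
... | tri≈ _ refl _ = begin
  δ (A * P + x) (A * P + T)                     ≡⟨ δ-+ (A * P) x T ⟩
  δ x T                                         ≡⟨ 1*y+0*z≡y (δ x T) (δ x (P + T)) ⟨
  1 * δ x T + 0 * δ x (P + T)                   ≡⟨ cong₂ (λ u v → u * δ x T + v * δ x (P + T)) (δ-refl A) (δ-≢ (1+n≢n {A})) ⟨
  δ A A * δ x T + δ (suc A) A * δ x (P + T)     ∎
  where
  open ≡-Reasoning
  1*y+0*z≡y : ∀ y z → 1 * y + 0 * z ≡ y
  1*y+0*z≡y = solve-∀
... | tri> _ _ Q<A =
  trans (δ-≢ (≢-sym (<⇒≢ (quotient-<⇒< x T<P Q<A))))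
        (sym (cong₂ (λ u v → u * δ x T + v * δ x (P + T)) (δ-≢ (>⇒≢ Q<A)) (δ-≢ (>⇒≢ (m<n⇒m<1+n Q<A)))))
... | tri< A<Q _ _ with m≤n⇒m<n∨m≡n A<Q
...   | inj₂ refl = begin
  δ (A * P + x) (suc A * P + T)                 ≡⟨ cong (δ (A * P + x)) (regroup A P T) ⟩
  δ (A * P + x) (A * P + (P + T))               ≡⟨ δ-+ (A * P) x (P + T) ⟩
  δ x (P + T)                                   ≡⟨ 0*y+1*z≡z (δ x T) (δ x (P + T)) ⟨
  0 * δ x T + 1 * δ x (P + T)                   ≡⟨ cong₂ (λ u v → u * δ x T + v * δ x (P + T)) (δ-≢ (≢-sym (1+n≢n {A}))) (δ-refl (suc A)) ⟨
  δ A (suc A) * δ x T + δ (suc A) (suc A) * δ x (P + T) ∎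
  where
  open ≡-Reasoning
  regroup : ∀ A P T → P + A * P + T ≡ A * P + (P + T)
  regroup = solve-∀
  0*y+1*z≡z : ∀ y z → 0 * y + 1 * z ≡ z
  0*y+1*z≡z = solve-∀
...   | inj₁ 1+A<Q =
  trans (δ-≢ (<⇒≢ (quotient-2+≤⇒< T x<2P 1+A<Q)))
        (sym (cong₂ (λ u v → u * δ x T + v * δ x (P + T)) (δ-≢ (<⇒≢ A<Q)) (δ-≢ (<⇒≢ 1+A<Q))))

count : {A : Set} → (A → Bool) → List A → ℕ
count p xs = length (filterᵇ p xs)

count-++ : {A : Set} (p : A → Bool) (xs ys : List A) → count p (xs ++ ys) ≡ count p xs + count p ys
count-++ p []       ys = refl
count-++ p (x ∷ xs) ys with p x
... | true  = cong suc (count-++ p xs ys)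
... | false = count-++ p xs ys

count-concatMap : {A B : Set} (p : B → Bool) (g : A → List B) (xs : List A) →
  count p (concatMap g xs) ≡ sum (map (λ x → count p (g x)) xs)
count-concatMap p g []       = refl
count-concatMap p g (x ∷ xs) =
  trans (count-++ p (g x) (concatMap g xs)) (cong (count p (g x) +_) (count-concatMap p g xs))

count-map : {A B : Set} (p : B → Bool) (h : A → B) (xs : List A) →
  count p (map h xs) ≡ count (λ x → p (h x)) xs
count-map p h []       = refl
count-map p h (x ∷ xs) with p (h x)
... | true  = cong suc (count-map p h xs)
... | false = count-map p h xs

count-false : {A : Set} (xs : List A) → count (λ _ → false) xs ≡ 0
count-false []       = refl
count-false (x ∷ xs) = count-false xs

length-concatMap : {A B : Set} (g : A → List B) (xs : List A) →
  length (concatMap g xs) ≡ sum (map (λ x → length (g x)) xs)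
length-concatMap g []       = refl
length-concatMap g (x ∷ xs) = trans (length-++ (g x)) (cong (length (g x) +_) (length-concatMap g xs))

module Counting (b : ℕ) where

  digitStep : ℕ → ℕ → ℕ
  digitStep acc d = acc * b + d

  -- wordSum m acc φ sums φ over the values of all words acc·w with w ∈ {0,…,b}^m,
  -- the prefix acc being read as one leading digit.
  wordSum : ℕ → ℕ → (ℕ → ℕ) → ℕ
  wordSum zero    acc φ = φ acc
  wordSum (suc m) acc φ = ∑[ d < suc b ] wordSum m (digitStep acc d) φ

  rep : ℕ → ℕ → ℕ
  rep m v = wordSum m 0 (λ u → δ u v)

  repPred : ℕ → ℕ → ℕ
  repPred m zero    = 0
  repPred m (suc Q) = rep m Q

  -- Padding with leading zeros identifies the over-expansions of v with the words of length v + 1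
  -- of value v (none is longer), so over v = s_b(v + 1).
  over : ℕ → ℕ
  over v = rep (suc v) v

  overPred : ℕ → ℕ
  overPred zero    = 0
  overPred (suc Q) = over Q

  count-words : ∀ m acc v →
    count (λ w → foldl digitStep acc w ≡ᵇ v) (words b m) ≡ wordSum m acc (λ u → δ u v)
  count-words zero    acc v with acc ≡ᵇ v
  ... | true  = refl
  ... | false = refl
  count-words (suc m) acc v = begin
    count p (concatMap (λ d → map (d ∷_) (words b m)) (upTo (suc b)))
      ≡⟨ count-concatMap p (λ d → map (d ∷_) (words b m)) (upTo (suc b)) ⟩
    sum (map (λ d → count p (map (d ∷_) (words b m))) (upTo (suc b)))
      ≡⟨ cong sum (map-cong (λ d → trans (count-map p (d ∷_) (words b m)) (count-words m (digitStep acc d) v)) (upTo (suc b))) ⟩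
    sum (map (λ d → wordSum m (digitStep acc d) (λ u → δ u v)) (upTo (suc b)))
      ≡⟨ sum-map-upTo (suc b) (λ d → wordSum m (digitStep acc d) (λ u → δ u v)) ⟩
    wordSum (suc m) acc (λ u → δ u v) ∎
    where
    open ≡-Reasoning
    p = λ w → foldl digitStep acc w ≡ᵇ v

  count-overExp-words : ∀ N m → count (isOverExp b N) (words b (suc m)) + rep m N ≡ rep (suc m) N
  count-overExp-words N m = begin
    count (isOverExp b N) (words b (suc m)) + rep m N
      ≡⟨ cong (_+ rep m N) (count-concatMap (isOverExp b N) (λ d → map (d ∷_) (words b m)) (upTo (suc b))) ⟩
    sum (map (λ d → count (isOverExp b N) (map (d ∷_) (words b m))) (upTo (suc b))) + rep m N
      ≡⟨ cong (_+ rep m N) (sum-map-upTo (suc b) (λ d → count (isOverExp b N) (map (d ∷_) (words b m)))) ⟩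
    count (isOverExp b N) (map (0 ∷_) (words b m)) + ∑[ d < b ] count (isOverExp b N) (map (suc d ∷_) (words b m)) + rep m N
      ≡⟨ cong (λ z → z + ∑[ d < b ] count (isOverExp b N) (map (suc d ∷_) (words b m)) + rep m N) (trans (count-map _ (0 ∷_) (words b m)) (count-false (words b m))) ⟩
    ∑[ d < b ] count (isOverExp b N) (map (suc d ∷_) (words b m)) + rep m N
      ≡⟨ +-comm _ (rep m N) ⟩
    rep m N + ∑[ d < b ] count (isOverExp b N) (map (suc d ∷_) (words b m))
      ≡⟨ cong (rep m N +_) (∑-cong b (λ d → trans (count-map _ (suc d ∷_) (words b m)) (count-words m (suc d) N))) ⟩
    rep (suc m) N ∎
    where open ≡-Reasoning

  s≡over : ∀ v → s b (suc v) ≡ over v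
  s≡over zero    = sym (∑-δ-≤ b 0 z≤n)
  s≡over (suc N) = begin
    length (overExpansions b (suc N))
      ≡⟨ length-concatMap (λ m → filterᵇ (isOverExp b (suc N)) (words b (suc m))) (upTo (suc (suc N))) ⟩
    sum (map (λ m → count (isOverExp b (suc N)) (words b (suc m))) (upTo (suc (suc N))))
      ≡⟨ sum-map-upTo (suc (suc N)) (λ m → count (isOverExp b (suc N)) (words b (suc m))) ⟩
    ∑[ m < suc (suc N) ] count (isOverExp b (suc N)) (words b (suc m))
      ≡⟨ +-identityʳ _ ⟨
    ∑[ m < suc (suc N) ] count (isOverExp b (suc N)) (words b (suc m)) + rep 0 (suc N)
      ≡⟨ ∑-telescope (suc (suc N)) (λ m → count (isOverExp b (suc N)) (words b (suc m))) (λ m → rep m (suc N)) (count-overExp-words (suc N)) ⟩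
    over (suc N) ∎
    where open ≡-Reasoning

  wordSum-cong : ∀ m acc {φ ψ} → (∀ u → φ u ≡ ψ u) → wordSum m acc φ ≡ wordSum m acc ψ
  wordSum-cong zero    acc φ≗ψ = φ≗ψ acc
  wordSum-cong (suc m) acc φ≗ψ = ∑-cong (suc b) (λ d → wordSum-cong m (digitStep acc d) φ≗ψ)

  wordSum-+ : ∀ m acc φ ψ → wordSum m acc (λ u → φ u + ψ u) ≡ wordSum m acc φ + wordSum m acc ψ
  wordSum-+ zero    acc φ ψ = refl
  wordSum-+ (suc m) acc φ ψ =
    trans (∑-cong (suc b) (λ d → wordSum-+ m (digitStep acc d) φ ψ))
          (∑-distrib-+ (suc b) (λ d → wordSum m (digitStep acc d) φ) (λ d → wordSum m (digitStep acc d) ψ))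

  wordSum-*ˡ : ∀ m acc c φ → wordSum m acc (λ u → c * φ u) ≡ c * wordSum m acc φ
  wordSum-*ˡ zero    acc c φ = refl
  wordSum-*ˡ (suc m) acc c φ =
    trans (∑-cong (suc b) (λ d → wordSum-*ˡ m (digitStep acc d) c φ))
          (∑-distribˡ-* (suc b) c (λ d → wordSum m (digitStep acc d) φ))

  wordSum-*ʳ : ∀ m acc c φ → wordSum m acc (λ u → φ u * c) ≡ wordSum m acc φ * c
  wordSum-*ʳ m acc c φ =
    trans (wordSum-cong m acc (λ u → *-comm (φ u) c)) (trans (wordSum-*ˡ m acc c φ) (*-comm c _))

  wordSum-zero : ∀ m acc → wordSum m acc (λ _ → 0) ≡ 0
  wordSum-zero m acc = wordSum-*ˡ m acc 0 (λ _ → 0)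

  wordSum-++ : ∀ m j acc φ → wordSum (m + j) acc φ ≡ wordSum m acc (λ u → wordSum j u φ)
  wordSum-++ zero    j acc φ = refl
  wordSum-++ (suc m) j acc φ = ∑-cong (suc b) (λ d → wordSum-++ m j (digitStep acc d) φ)

  wordSum-shift : ∀ j A φ → wordSum j A φ ≡ wordSum j 0 (λ x → φ (A * b ^ j + x))
  wordSum-shift zero    A φ = cong φ (sym (trans (+-identityʳ _) (*-identityʳ A)))
  wordSum-shift (suc j) A φ = ∑-cong (suc b) λ d → begin
    wordSum j (A * b + d) φ
      ≡⟨ wordSum-shift j (A * b + d) φ ⟩
    wordSum j 0 (λ x → φ ((A * b + d) * b ^ j + x))
      ≡⟨ wordSum-cong j 0 (λ x → cong φ (reassociate A b d (b ^ j) x)) ⟩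
    wordSum j 0 (λ x → φ (A * (b * b ^ j) + (d * b ^ j + x)))
      ≡⟨ wordSum-shift j d (λ x → φ (A * (b * b ^ j) + x)) ⟨
    wordSum j d (λ x → φ (A * (b * b ^ j) + x)) ∎
    where
    open ≡-Reasoning
    reassociate : ∀ A b d P x → (A * b + d) * P + x ≡ A * (b * P) + (d * P + x)
    reassociate = solve-∀

  wordSum-δ-suc : ∀ m Q → wordSum m 0 (λ u → δ (suc u) Q) ≡ repPred m Q
  wordSum-δ-suc m zero    = wordSum-zero m 0
  wordSum-δ-suc m (suc Q) = refl

module Representations (b : ℕ) (2≤b : 2 ≤ b) where
  open Counting b

  digit-prefix-< : ∀ {d x P} → d ≤ b → suc x < 2 * P → suc (d * P + x) < 2 * (b * P)
  digit-prefix-< {d} {x} {P} d≤b x<2P = begin-strict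
    suc (d * P + x)  ≡⟨ +-suc (d * P) x ⟨
    d * P + suc x    <⟨ +-monoʳ-< (d * P) x<2P ⟩
    d * P + 2 * P    ≤⟨ +-mono-≤ (*-monoˡ-≤ P d≤b) (*-monoˡ-≤ P 2≤b) ⟩
    b * P + b * P    ≡⟨ cong (b * P +_) (+-identityʳ (b * P)) ⟨
    2 * (b * P)      ∎
    where open ≤-Reasoning

  -- Every word of length j has value below 2 * b ^ j − 1.
  wordSum-cong-bounded : ∀ j {φ ψ} → (∀ x → suc x < 2 * b ^ j → φ x ≡ ψ x) → wordSum j 0 φ ≡ wordSum j 0 ψ
  wordSum-cong-bounded zero    φ≗ψ = φ≗ψ 0 (s≤s (s≤s z≤n))
  wordSum-cong-bounded (suc j) {φ} {ψ} φ≗ψ = ∑-cong-< (suc b) λ d d<1+b → begin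
    wordSum j d φ                               ≡⟨ wordSum-shift j d φ ⟩
    wordSum j 0 (λ x → φ (d * b ^ j + x))       ≡⟨ wordSum-cong-bounded j (λ x x<2P → φ≗ψ _ (digit-prefix-< (≤-pred d<1+b) x<2P)) ⟩
    wordSum j 0 (λ x → ψ (d * b ^ j + x))       ≡⟨ wordSum-shift j d ψ ⟨
    wordSum j d ψ                               ∎
    where open ≡-Reasoning

  rep-split : ∀ m j Q T → T < b ^ j →
    rep (m + j) (Q * b ^ j + T) ≡ rep m Q * rep j T + repPred m Q * rep j (b ^ j + T)
  rep-split m j Q T T<P = begin
    wordSum (m + j) 0 (λ u → δ u V)
      ≡⟨ wordSum-++ m j 0 (λ u → δ u V) ⟩
    wordSum m 0 (λ A → wordSum j A (λ u → δ u V))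
      ≡⟨ wordSum-cong m 0 (λ A → wordSum-shift j A (λ u → δ u V)) ⟩
    wordSum m 0 (λ A → wordSum j 0 (λ x → δ (A * b ^ j + x) V))
      ≡⟨ wordSum-cong m 0 (λ A → wordSum-cong-bounded j (λ x → δ-split A Q x T (b ^ j) T<P)) ⟩
    wordSum m 0 (λ A → wordSum j 0 (λ x → δ A Q * δ x T + δ (suc A) Q * δ x (b ^ j + T)))
      ≡⟨ wordSum-cong m 0 (λ A → distribute A) ⟩
    wordSum m 0 (λ A → δ A Q * rep j T + δ (suc A) Q * rep j (b ^ j + T))
      ≡⟨ wordSum-+ m 0 (λ A → δ A Q * rep j T) (λ A → δ (suc A) Q * rep j (b ^ j + T)) ⟩
    wordSum m 0 (λ A → δ A Q * rep j T) + wordSum m 0 (λ A → δ (suc A) Q * rep j (b ^ j + T))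
      ≡⟨ cong₂ _+_ (wordSum-*ʳ m 0 (rep j T) (λ A → δ A Q)) (wordSum-*ʳ m 0 (rep j (b ^ j + T)) (λ A → δ (suc A) Q)) ⟩
    rep m Q * rep j T + wordSum m 0 (λ A → δ (suc A) Q) * rep j (b ^ j + T)
      ≡⟨ cong (λ z → rep m Q * rep j T + z * rep j (b ^ j + T)) (wordSum-δ-suc m Q) ⟩
    rep m Q * rep j T + repPred m Q * rep j (b ^ j + T) ∎
    where
    open ≡-Reasoning
    V = Q * b ^ j + T
    distribute : ∀ A → wordSum j 0 (λ x → δ A Q * δ x T + δ (suc A) Q * δ x (b ^ j + T))
                     ≡ δ A Q * rep j T + δ (suc A) Q * rep j (b ^ j + T)
    distribute A = trans (wordSum-+ j 0 (λ x → δ A Q * δ x T) (λ x → δ (suc A) Q * δ x (b ^ j + T)))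
                         (cong₂ _+_ (wordSum-*ˡ j 0 (δ A Q) (λ x → δ x T)) (wordSum-*ˡ j 0 (δ (suc A) Q) (λ x → δ x (b ^ j + T))))

  1≤b : 1 ≤ b
  1≤b = ≤-trans (s≤s z≤n) 2≤b

  instance
    b-nonZero : NonZero b
    b-nonZero = >-nonZero 1≤b

  b^n+b^n≤b^[1+n] : ∀ n → b ^ n + b ^ n ≤ b ^ suc n
  b^n+b^n≤b^[1+n] n = subst (_≤ b ^ suc n) (cong (b ^ n +_) (+-identityʳ (b ^ n))) (*-monoˡ-≤ (b ^ n) 2≤b)

  n<b^n : ∀ n → n < b ^ n
  n<b^n zero    = s≤s z≤n
  n<b^n (suc n) = begin-strict
    suc n          ≤⟨ n<b^n n ⟩
    b ^ n          <⟨ m<m+n (b ^ n) (m^n>0 b n) ⟩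
    b ^ n + b ^ n  ≤⟨ b^n+b^n≤b^[1+n] n ⟩
    b ^ suc n      ∎
    where open ≤-Reasoning

  rep-1-≤ : ∀ {v} → v ≤ b → rep 1 v ≡ 1
  rep-1-≤ {v} = ∑-δ-≤ b v

  rep-1-> : ∀ {v} → b < v → rep 1 v ≡ 0
  rep-1-> {v} = ∑-δ-> b v

  repPred-pred : ∀ m {Q} → 1 ≤ Q → repPred m Q ≡ rep m (Q ∸ 1)
  repPred-pred m {suc Q} _ = refl

  rep-digit : ∀ m Q d → d < b → rep (suc m) (Q * b + d) ≡ rep m Q * rep 1 d + repPred m Q * rep 1 (b + d)
  rep-digit m Q d d<b = begin
    rep (suc m) (Q * b + d)          ≡⟨ cong₂ (λ L P → rep L (Q * P + d)) (+-comm m 1) (*-identityʳ b) ⟨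
    rep (m + 1) (Q * b ^ 1 + d)      ≡⟨ rep-split m 1 Q d (subst (d <_) (sym (*-identityʳ b)) d<b) ⟩
    rep m Q * rep 1 d + repPred m Q * rep 1 (b ^ 1 + d)
                                     ≡⟨ cong (λ P → rep m Q * rep 1 d + repPred m Q * rep 1 (P + d)) (*-identityʳ b) ⟩
    rep m Q * rep 1 d + repPred m Q * rep 1 (b + d) ∎
    where open ≡-Reasoning

  rep-zero : ∀ m → rep m 0 ≡ 1
  rep-zero zero    = refl
  rep-zero (suc m) = begin
    rep (suc m) (0 * b + 0)         ≡⟨ rep-digit m 0 0 1≤b ⟩
    rep m 0 * rep 1 0 + 0           ≡⟨ cong₂ (λ u v → u * v + 0) (rep-zero m) (rep-1-≤ z≤n) ⟩
    1                               ∎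
    where open ≡-Reasoning

  rep-pad : ∀ m j T → T < b ^ j → rep (m + j) T ≡ rep j T
  rep-pad m j T T<P = begin
    rep (m + j) (0 * b ^ j + T)                         ≡⟨ rep-split m j 0 T T<P ⟩
    rep m 0 * rep j T + 0                               ≡⟨ cong (λ u → u * rep j T + 0) (rep-zero m) ⟩
    1 * rep j T + 0                                     ≡⟨ trans (+-identityʳ _) (*-identityˡ _) ⟩
    rep j T                                             ∎
    where open ≡-Reasoning

  rep-length : ∀ a a' V → V < b ^ a → V < b ^ a' → rep a V ≡ rep a' V
  rep-length a a' V V<b^a V<b^a' = begin
    rep a V         ≡⟨ rep-pad a' a V V<b^a ⟨
    rep (a' + a) V  ≡⟨ cong (λ L → rep L V) (+-comm a' a) ⟩
    rep (a + a') V  ≡⟨ rep-pad a a' V V<b^a' ⟩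
    rep a' V        ∎
    where open ≡-Reasoning

  rep-pos : ∀ m v → v < b ^ m → 1 ≤ rep m v
  rep-pos zero    zero    _ = ≤-refl
  rep-pos zero    (suc v) (s≤s ())
  rep-pos (suc m) v v<b^1+m = begin
    1                                     ≤⟨ rep-pos m (v / b) (m<n*o⇒m/o<n (subst (v <_) (*-comm b (b ^ m)) v<b^1+m)) ⟩
    rep m (v / b)                         ≡⟨ *-identityʳ _ ⟨
    rep m (v / b) * 1                     ≡⟨ cong (rep m (v / b) *_) (rep-1-≤ (<⇒≤ (m%n<n v b))) ⟨
    rep m (v / b) * rep 1 (v % b)         ≤⟨ m≤m+n _ _ ⟩
    rep m (v / b) * rep 1 (v % b) + repPred m (v / b) * rep 1 (b + v % b)
                                          ≡⟨ rep-digit m (v / b) (v % b) (m%n<n v b) ⟨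
    rep (suc m) (v / b * b + v % b)       ≡⟨ cong (rep (suc m)) (trans (+-comm _ (v % b)) (sym (m≡m%n+[m/n]*n v b))) ⟩
    rep (suc m) v                         ∎
    where open ≤-Reasoning

  rep-leading-0 : ∀ j t → t < b ^ j → rep (suc j) t ≡ rep j t
  rep-leading-0 = rep-pad 1

  rep-leading-1 : ∀ j t → t < b ^ j → rep (suc j) (b ^ j + t) ≡ rep j t + rep j (b ^ j + t)
  rep-leading-1 j t t<P = begin
    rep (suc j) (b ^ j + t)                                ≡⟨ cong (λ z → rep (suc j) (z + t)) (*-identityˡ (b ^ j)) ⟨
    rep (suc j) (1 * b ^ j + t)                            ≡⟨ rep-split 1 j 1 t t<P ⟩
    rep 1 1 * rep j t + rep 1 0 * rep j (b ^ j + t)        ≡⟨ cong₂ (λ u v → u * rep j t + v * rep j (b ^ j + t)) (rep-1-≤ 1≤b) (rep-1-≤ z≤n) ⟩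
    1 * rep j t + 1 * rep j (b ^ j + t)                    ≡⟨ cong₂ _+_ (*-identityˡ (rep j t)) (*-identityˡ (rep j (b ^ j + t))) ⟩
    rep j t + rep j (b ^ j + t)                            ∎
    where open ≡-Reasoning

  rep-leading-b : ∀ j t → t < b ^ j → rep (suc j) (b ^ suc j + t) ≡ rep j t + rep j (b ^ j + t)
  rep-leading-b j t t<P = begin
    rep (suc j) (b * b ^ j + t)                            ≡⟨ rep-split 1 j b t t<P ⟩
    rep 1 b * rep j t + repPred 1 b * rep j (b ^ j + t)    ≡⟨ cong₂ (λ u v → u * rep j t + v * rep j (b ^ j + t)) (rep-1-≤ ≤-refl) (trans (repPred-pred 1 1≤b) (rep-1-≤ (m∸n≤m b 1))) ⟩
    1 * rep j t + 1 * rep j (b ^ j + t)                    ≡⟨ cong₂ _+_ (*-identityˡ (rep j t)) (*-identityˡ (rep j (b ^ j + t))) ⟩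
    rep j t + rep j (b ^ j + t)                            ∎
    where open ≡-Reasoning

  rep-leading-b+1 : ∀ j t → t < b ^ j → rep (suc j) (b ^ suc j + (b ^ j + t)) ≡ rep j (b ^ j + t)
  rep-leading-b+1 j t t<P = begin
    rep (suc j) (b * b ^ j + (b ^ j + t))                  ≡⟨ cong (rep (suc j)) (regroup b (b ^ j) t) ⟩
    rep (suc j) (suc b * b ^ j + t)                        ≡⟨ rep-split 1 j (suc b) t t<P ⟩
    rep 1 (suc b) * rep j t + rep 1 b * rep j (b ^ j + t)  ≡⟨ cong₂ (λ u v → u * rep j t + v * rep j (b ^ j + t)) (rep-1-> ≤-refl) (rep-1-≤ ≤-refl) ⟩
    1 * rep j (b ^ j + t)                                  ≡⟨ *-identityˡ _ ⟩
    rep j (b ^ j + t)                                      ∎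
    where
    open ≡-Reasoning
    regroup : ∀ b P t → b * P + (P + t) ≡ (P + b * P) + t
    regroup = solve-∀

  n<b^1+n : ∀ n → n < b ^ suc n
  n<b^1+n n = <-trans (n<1+n n) (n<b^n (suc n))

  over-pos : ∀ v → 1 ≤ over v
  over-pos v = rep-pos (suc v) v (n<b^1+n v)

  repPred≡overPred : ∀ Q → repPred (suc Q) Q ≡ overPred Q
  repPred≡overPred zero    = refl
  repPred≡overPred (suc Q) = rep-leading-0 (suc Q) Q (n<b^1+n Q)

  Q*b^j+T<b^[1+Q+j] : ∀ {j T} Q → T < b ^ j → Q * b ^ j + T < b ^ (suc Q + j)
  Q*b^j+T<b^[1+Q+j] {j} {T} Q T<P = begin-strict
    Q * b ^ j + T      <⟨ quotient-<⇒< 0 T<P (n<1+n Q) ⟩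
    suc Q * b ^ j + 0  ≡⟨ +-identityʳ _ ⟩
    suc Q * b ^ j      ≤⟨ *-monoˡ-≤ (b ^ j) (<⇒≤ (n<b^n (suc Q))) ⟩
    b ^ suc Q * b ^ j  ≡⟨ ^-distribˡ-+-* b (suc Q) j ⟨
    b ^ (suc Q + j)    ∎
    where open ≤-Reasoning

  over-split : ∀ j Q T → T < b ^ j → over (Q * b ^ j + T) ≡ over Q * rep j T + overPred Q * rep j (b ^ j + T)
  over-split j Q T T<P = begin
    rep (suc V) V
      ≡⟨ rep-length (suc V) (suc Q + j) V (n<b^1+n V) (Q*b^j+T<b^[1+Q+j] Q T<P) ⟩
    rep (suc Q + j) V
      ≡⟨ rep-split (suc Q) j Q T T<P ⟩
    over Q * rep j T + repPred (suc Q) Q * rep j (b ^ j + T)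
      ≡⟨ cong (λ z → over Q * rep j T + z * rep j (b ^ j + T)) (repPred≡overPred Q) ⟩
    over Q * rep j T + overPred Q * rep j (b ^ j + T) ∎
    where
    open ≡-Reasoning
    V = Q * b ^ j + T

  over-digit : ∀ Q d → d < b → over (Q * b + d) ≡ over Q * rep 1 d + overPred Q * rep 1 (b + d)
  over-digit Q d d<b = begin
    over (Q * b + d)                                      ≡⟨ cong (λ P → over (Q * P + d)) (*-identityʳ b) ⟨
    over (Q * b ^ 1 + d)                                  ≡⟨ over-split 1 Q d (subst (d <_) (sym (*-identityʳ b)) d<b) ⟩
    over Q * rep 1 d + overPred Q * rep 1 (b ^ 1 + d)     ≡⟨ cong (λ P → over Q * rep 1 d + overPred Q * rep 1 (P + d)) (*-identityʳ b) ⟩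
    over Q * rep 1 d + overPred Q * rep 1 (b + d)         ∎
    where open ≡-Reasoning

  overPred-<-over-* : ∀ Q → overPred (Q * b) < over (Q * b)
  overPred-<-over-* zero    = subst (0 <_) (sym (rep-1-≤ z≤n)) (s≤s z≤n)
  overPred-<-over-* (suc q) = begin-strict
    overPred (suc q * b)                          ≡⟨ cong overPred ([1+q]*b≡1+[q*b+[b∸1]]) ⟩
    over (q * b + (b ∸ 1))                        ≡⟨ over-digit q (b ∸ 1) (≤-reflexive (suc-pred b)) ⟩
    over q * rep 1 (b ∸ 1) + overPred q * rep 1 (b + (b ∸ 1))
                                                  ≡⟨ cong₂ (λ u v → over q * u + overPred q * v) (rep-1-≤ (m∸n≤m b 1)) (rep-1-> (m<m+n b (∸-monoˡ-≤ 1 2≤b))) ⟩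
    over q * 1 + overPred q * 0                   ≡⟨ cong₂ _+_ (*-identityʳ (over q)) (*-zeroʳ (overPred q)) ⟩
    over q + 0                                    ≡⟨ +-identityʳ (over q) ⟩
    over q                                        <⟨ m<n+m (over q) (over-pos (suc q)) ⟩
    over (suc q) + over q                         ≡⟨ cong₂ _+_ (*-identityʳ (over (suc q))) (*-identityʳ (over q)) ⟨
    over (suc q) * 1 + over q * 1                 ≡⟨ cong₂ (λ u v → over (suc q) * u + over q * v) (rep-1-≤ z≤n) (rep-1-≤ (≤-reflexive (+-identityʳ b))) ⟨
    over (suc q) * rep 1 0 + over q * rep 1 (b + 0) ≡⟨ over-digit (suc q) 0 1≤b ⟨
    over (suc q * b + 0)                          ≡⟨ cong over (+-identityʳ (suc q * b)) ⟩
    over (suc q * b)                              ∎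
    where
    open ≤-Reasoning
    [1+q]*b≡1+[q*b+[b∸1]] : suc q * b ≡ suc (q * b + (b ∸ 1))
    [1+q]*b≡1+[q*b+[b∸1]] = begin-equality
      b + q * b              ≡⟨ cong (_+ q * b) (suc-pred b) ⟨
      suc (b ∸ 1) + q * b    ≡⟨ cong suc (+-comm (b ∸ 1) (q * b)) ⟩
      suc (q * b + (b ∸ 1))  ∎

  b^n+t<b^[1+n] : ∀ n {t} → t < b ^ n → b ^ n + t < b ^ suc n
  b^n+t<b^[1+n] n {t} t<b^n = begin-strict
    b ^ n + t      <⟨ +-monoʳ-< (b ^ n) t<b^n ⟩
    b ^ n + b ^ n  ≤⟨ b^n+b^n≤b^[1+n] n ⟩
    b ^ suc n      ∎
    where open ≤-Reasoning

  data Binary : ℕ → ℕ → Set where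
    []  : Binary 0 0
    0∷_ : ∀ {j t} → Binary j t → Binary (suc j) t
    1∷_ : ∀ {j t} → Binary j t → Binary (suc j) (b ^ j + t)

  binary-< : ∀ {j t} → Binary j t → t < b ^ j
  binary-< []              = s≤s z≤n
  binary-< (0∷_ {j} bin)   = <-≤-trans (binary-< bin) (m≤n*m (b ^ j) b)
  binary-< (1∷_ {j} {t} bin) = b^n+t<b^[1+n] j (binary-< bin)

  binary-pad : ∀ {j t} d → Binary j t → Binary (d + j) t
  binary-pad zero    bin = bin
  binary-pad (suc d) bin = 0∷ binary-pad d bin

  binary-≤ : ∀ {j j' t} → j ≤ j' → Binary j t → Binary j' t
  binary-≤ {j} {j'} j≤j' bin = subst (λ i → Binary i _) (m∸n+n≡m j≤j') (binary-pad (j' ∸ j) bin)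

  binary-rep≡1 : ∀ {j t} → Binary j t → rep j (b ^ j + t) ≡ 0 → rep j t ≡ 1
  binary-rep≡1 []                  _   = refl
  binary-rep≡1 (0∷_ {j} {t} bin)  ≡0  =
    contradiction (m+n≡0⇒m≡0 (rep j t) (trans (sym (rep-leading-b j t (binary-< bin))) ≡0))
                  (≢-sym (<⇒≢ (rep-pos j t (binary-< bin))))
  binary-rep≡1 (1∷_ {j} {t} bin)  ≡0  = begin
    rep (suc j) (b ^ j + t)        ≡⟨ rep-leading-1 j t (binary-< bin) ⟩
    rep j t + rep j (b ^ j + t)    ≡⟨ cong₂ _+_ (binary-rep≡1 bin high≡0) high≡0 ⟩
    1                              ∎
    where
    open ≡-Reasoning
    high≡0 : rep j (b ^ j + t) ≡ 0
    high≡0 = trans (sym (rep-leading-b+1 j t (binary-< bin))) ≡0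

  record Swap (j t : ℕ) : Set where
    constructor swap
    field
      {t'}     : ℕ
      binary   : Binary j t'
      rep-low  : rep j t' ≡ rep j (b ^ j + t)
      rep-high : rep j (b ^ j + t') ≡ rep j t

  -- When rep j (b ^ j + t) = 0 the pair attached to 0∷ t is (x, x), so t is its own swap.
  swap-refl : ∀ {j t} → Binary j t → rep j (b ^ j + t) ≡ 0 → Swap (suc j) t
  swap-refl {j} {t} bin high≡0 = swap (0∷ bin) (sym pair-equal) pair-equal
    where
    open ≡-Reasoning
    pair-equal : rep (suc j) (b ^ suc j + t) ≡ rep (suc j) t
    pair-equal = begin
      rep (suc j) (b ^ suc j + t)  ≡⟨ rep-leading-b j t (binary-< bin) ⟩
      rep j t + rep j (b ^ j + t)  ≡⟨ cong (rep j t +_) high≡0 ⟩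
      rep j t + 0                  ≡⟨ +-identityʳ (rep j t) ⟩
      rep j t                      ≡⟨ rep-leading-0 j t (binary-< bin) ⟨
      rep (suc j) t                ∎

  swap-0∷ : ∀ {j t} → Binary j t → Swap j t → Swap (suc j) t
  swap-0∷ {j} {t} bin (swap {t''} bin'' low high) = swap (1∷ bin'')
    (begin
      rep (suc j) (b ^ j + t'')         ≡⟨ rep-leading-1 j t'' (binary-< bin'') ⟩
      rep j t'' + rep j (b ^ j + t'')   ≡⟨ cong₂ _+_ low high ⟩
      rep j (b ^ j + t) + rep j t       ≡⟨ +-comm (rep j (b ^ j + t)) (rep j t) ⟩
      rep j t + rep j (b ^ j + t)       ≡⟨ rep-leading-b j t (binary-< bin) ⟨
      rep (suc j) (b ^ suc j + t)       ∎)
    (begin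
      rep (suc j) (b ^ suc j + (b ^ j + t''))  ≡⟨ rep-leading-b+1 j t'' (binary-< bin'') ⟩
      rep j (b ^ j + t'')                      ≡⟨ high ⟩
      rep j t                                  ≡⟨ rep-leading-0 j t (binary-< bin) ⟨
      rep (suc j) t                            ∎)
    where open ≡-Reasoning

  swap-1∷ : ∀ {j t} → Binary j t → Swap j t → Swap (suc j) (b ^ j + t)
  swap-1∷ {j} {t} bin (swap {t''} bin'' low high) = swap (0∷ bin'')
    (begin
      rep (suc j) t''                          ≡⟨ rep-leading-0 j t'' (binary-< bin'') ⟩
      rep j t''                                ≡⟨ low ⟩
      rep j (b ^ j + t)                        ≡⟨ rep-leading-b+1 j t (binary-< bin) ⟨
      rep (suc j) (b ^ suc j + (b ^ j + t))    ∎)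
    (begin
      rep (suc j) (b ^ suc j + t'')            ≡⟨ rep-leading-b j t'' (binary-< bin'') ⟩
      rep j t'' + rep j (b ^ j + t'')          ≡⟨ cong₂ _+_ low high ⟩
      rep j (b ^ j + t) + rep j t              ≡⟨ +-comm (rep j (b ^ j + t)) (rep j t) ⟩
      rep j t + rep j (b ^ j + t)              ≡⟨ rep-leading-1 j t (binary-< bin) ⟨
      rep (suc j) (b ^ j + t)                  ∎)
    where open ≡-Reasoning

  binary-swap : ∀ {j t} → Binary j t → 1 ≤ rep j (b ^ j + t) → Swap j t
  binary-swap []                ()
  binary-swap (0∷_ {j} {t} bin) _ with rep j (b ^ j + t) in high
  ... | zero  = swap-refl bin high
  ... | suc _ = swap-0∷ bin (binary-swap bin (subst (1 ≤_) (sym high) (s≤s z≤n)))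
  binary-swap (1∷_ {j} {t} bin) 1≤high =
    swap-1∷ bin (binary-swap bin (subst (1 ≤_) (rep-leading-b+1 j t (binary-< bin)) 1≤high))

  over-block-0 : ∀ n Q {t} → t < b ^ n →
    over (Q * b ^ suc n + t) ≡ over Q * rep n t + overPred Q * (rep n t + rep n (b ^ n + t))
  over-block-0 n Q {t} t<b^n =
    trans (over-split (suc n) Q t (<-≤-trans t<b^n (m≤n*m (b ^ n) b)))
          (cong₂ (λ u v → over Q * u + overPred Q * v) (rep-leading-0 n t t<b^n) (rep-leading-b n t t<b^n))

  over-block-1 : ∀ n Q {t} → t < b ^ n →
    over (Q * b ^ suc n + (b ^ n + t)) ≡ over Q * (rep n t + rep n (b ^ n + t)) + overPred Q * rep n (b ^ n + t)
  over-block-1 n Q {t} t<b^n =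
    trans (over-split (suc n) Q (b ^ n + t) (b^n+t<b^[1+n] n t<b^n))
          (cong₂ (λ u v → over Q * u + overPred Q * v) (rep-leading-1 n t t<b^n) (rep-leading-b+1 n t t<b^n))

  -- With p = over Q, q = overPred Q, x = rep n t and y = rep n (b ^ n + t), the tail t scores
  -- p x + q (x + y). If y = 0 then x = 1 and the block start does as well; otherwise the tail
  -- with the swapped pair (y, x) scores p (y + x) + q x, larger by (p − q) y.
  exchange : ∀ n Q {t} → overPred Q < over Q → Binary n t →
    over (Q * b ^ suc n + t) ≤ over (Q * b ^ suc n)
    ⊎ ∃[ T ] T < b ^ suc n × over (Q * b ^ suc n + t) < over (Q * b ^ suc n + T)
  exchange n Q {t} q<p bin with rep n (b ^ n + t) in high≡
  ... | zero = inj₁ (begin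
    over (Q * b ^ suc n + t)                 ≡⟨ over-block-0 n Q (binary-< bin) ⟩
    p * x + q * (x + rep n (b ^ n + t))      ≡⟨ cong (λ z → p * x + q * (x + z)) high≡ ⟩
    p * x + q * (x + 0)                      ≡⟨ cong (λ z → p * z + q * (z + 0)) (binary-rep≡1 bin high≡) ⟩
    p * 1 + q * (1 + 0)                      ≤⟨ +-monoʳ-≤ (p * 1) (*-monoʳ-≤ q start≥1) ⟩
    p * 1 + q * rep (suc n) (b ^ suc n + 0)  ≡⟨ cong (λ z → p * z + q * rep (suc n) (b ^ suc n + 0)) (rep-zero (suc n)) ⟨
    p * rep (suc n) 0 + q * rep (suc n) (b ^ suc n + 0)
                                             ≡⟨ over-split (suc n) Q 0 (m^n>0 b (suc n)) ⟨
    over (Q * b ^ suc n + 0)                 ≡⟨ cong over (+-identityʳ (Q * b ^ suc n)) ⟩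
    over (Q * b ^ suc n)                     ∎)
    where
    open ≤-Reasoning
    p = over Q
    q = overPred Q
    x = rep n t
    start≥1 : 1 + 0 ≤ rep (suc n) (b ^ suc n + 0)
    start≥1 = subst (1 + 0 ≤_) (sym (rep-leading-b n 0 (m^n>0 b n)))
                    (subst (_≤ rep n 0 + rep n (b ^ n + 0)) (rep-zero n) (m≤m+n _ _))
  ... | suc _ with binary-swap bin (subst (1 ≤_) (sym high≡) (s≤s z≤n))
  ...   | swap {t''} bin'' low high = inj₂ (b ^ n + t'' , binary-< (1∷ bin'') , (begin-strict
    over (Q * b ^ suc n + t)                 ≡⟨ over-block-0 n Q (binary-< bin) ⟩
    p * x + q * (x + y)                      ≡⟨ regroup p q x y ⟩
    p * x + q * x + q * y                    <⟨ +-monoʳ-< (p * x + q * x) (*-monoˡ-< y {{y≢0}} q<p) ⟩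
    p * x + q * x + p * y                    ≡⟨ regroup' p q x y ⟩
    p * (y + x) + q * x                      ≡⟨ cong₂ (λ u v → p * (u + v) + q * v) low high ⟨
    p * (rep n t'' + rep n (b ^ n + t'')) + q * rep n (b ^ n + t'')
                                             ≡⟨ over-block-1 n Q (binary-< bin'') ⟨
    over (Q * b ^ suc n + (b ^ n + t''))     ∎))
    where
    open ≤-Reasoning
    p = over Q
    q = overPred Q
    x = rep n t
    y = rep n (b ^ n + t)
    y≢0 : NonZero y
    y≢0 = >-nonZero (subst (0 <_) (sym high≡) (s≤s z≤n))
    regroup : ∀ p q x y → p * x + q * (x + y) ≡ p * x + q * x + q * y
    regroup = solve-∀
    regroup' : ∀ p q x y → p * x + q * x + p * y ≡ p * (y + x) + q * x
    regroup' = solve-∀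

multiple-<⇒≤ : ∀ {P H X} → P ∣ H → P ∣ X → H < X + P → H ≤ X
multiple-<⇒≤ {P} (divides q refl) (divides a refl) qP<aP+P =
  *-monoˡ-≤ P (≤-pred (*-cancelʳ-< P q (suc a) (subst (q * P <_) (+-comm (a * P) P) qP<aP+P)))

module PowerSums (b : ℕ) (2≤b : 2 ≤ b) where
  open Counting b
  open Representations b 2≤b

  ^-∣ : ∀ {a c} → a ≤ c → b ^ a ∣ b ^ c
  ^-∣ {a} {c} a≤c = divides (b ^ (c ∸ a)) (begin
    b ^ c                ≡⟨ cong (b ^_) (m∸n+n≡m a≤c) ⟨
    b ^ (c ∸ a + a)      ≡⟨ ^-distribˡ-+-* b (c ∸ a) a ⟩
    b ^ (c ∸ a) * b ^ a  ∎)
    where open ≡-Reasoning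

  ∑-alternate-powers-< : ∀ m a → 2 * m ≤ a → ∑[ i < suc m ] b ^ (a ∸ 2 * i) < b ^ suc a
  ∑-alternate-powers-< zero    a _ = begin-strict
    b ^ a + 0      ≡⟨ +-identityʳ (b ^ a) ⟩
    b ^ a          <⟨ m<m+n (b ^ a) (m^n>0 b a) ⟩
    b ^ a + b ^ a  ≤⟨ b^n+b^n≤b^[1+n] a ⟩
    b ^ suc a      ∎
    where open ≤-Reasoning
  ∑-alternate-powers-< (suc m) (suc (suc a)) 2m+2≤a+2 = begin-strict
    b ^ suc (suc a) + ∑[ i < suc m ] b ^ (suc (suc a) ∸ 2 * suc i)
      ≡⟨ cong (b ^ suc (suc a) +_) (∑-cong (suc m) (λ i → cong (λ z → b ^ (suc (suc a) ∸ z)) (*-suc 2 i))) ⟩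
    b ^ suc (suc a) + ∑[ i < suc m ] b ^ (a ∸ 2 * i)
      <⟨ +-monoʳ-< (b ^ suc (suc a)) (∑-alternate-powers-< m a 2m≤a) ⟩
    b ^ suc (suc a) + b ^ suc a
      ≤⟨ +-monoʳ-≤ (b ^ suc (suc a)) (^-monoʳ-≤ b (n≤1+n (suc a))) ⟩
    b ^ suc (suc a) + b ^ suc (suc a)
      ≤⟨ b^n+b^n≤b^[1+n] (suc (suc a)) ⟩
    b ^ suc (suc (suc a)) ∎
    where
    open ≤-Reasoning
    2m≤a : 2 * m ≤ a
    2m≤a = ≤-pred (≤-pred (subst (_≤ suc (suc a)) (*-suc 2 m) 2m+2≤a+2))
  ∑-alternate-powers-< (suc m) zero    ()
  ∑-alternate-powers-< (suc m) (suc zero) (s≤s 2m+1≤0) = contradiction (subst (_≤ 0) (+-suc m (m + 0)) 2m+1≤0) λ ()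

  binary-∑-powers : ∀ c {n} (e : ℕ → ℕ) → (∀ i → i < c → e i < e (suc i)) → e c < n →
    Binary n (∑[ i < suc c ] b ^ e i)
  binary-∑-powers zero    e _    e0<n = binary-≤ e0<n (1∷ binary-≤ z≤n [])
  binary-∑-powers (suc c) e incr ec<n =
    binary-≤ ec<n (subst (Binary (suc (e (suc c)))) sum-swap
      (1∷ binary-∑-powers c e (λ i i<c → incr i (m<n⇒m<1+n i<c)) (incr c (n<1+n c))))
    where
    sum-swap : b ^ e (suc c) + ∑[ i < suc c ] b ^ e i ≡ ∑[ i < suc (suc c) ] b ^ e i
    sum-swap = trans (+-comm (b ^ e (suc c)) _) (sym (∑-snoc (suc c) (λ i → b ^ e i)))

block-⊆-I : ∀ b k r y {H P T} → b ^ k ≤ H →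
  H + P ≤ b ^ k + sum (map (λ i → b ^ (r ∸ 2 * i)) (upTo (suc y))) → T < P → InI b k r y (suc (H + T))
block-⊆-I b k r y {H} {_} {T} b^k≤H block≤ T<P = s≤s (≤-trans b^k≤H (m≤m+n H T)) , ≤-trans (+-monoʳ-< H T<P) block≤

module Nu (b : ℕ) (2≤b : 2 ≤ b) where
  open Counting b
  open Representations b 2≤b

  binary-tail-⊥ : ∀ {k r y ν} n {H t} → IsNu b k r y ν → ν ≡ suc (H + t) → Binary n t → 1 ≤ t →
    b ^ suc (suc n) ∣ H → b ^ k ≤ H →
    H + b ^ suc n ≤ b ^ k + sum (map (λ i → b ^ (r ∸ 2 * i)) (upTo (suc y))) → ⊥
  binary-tail-⊥ {k} {r} {y} n {_} {t} (_ , maximal , minimal) refl bin 1≤t (divides Q' refl) b^k≤H block≤ =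
    [ beaten-by-start , beaten-inside-block ]′ (exchange n (Q' * b) (overPred-<-over-* Q') bin)
    where
    H = Q' * b ^ suc (suc n)
    block = Q' * b * b ^ suc n
    H≡block : H ≡ block
    H≡block = sym (*-assoc Q' b (b ^ suc n))
    s≡over-block : ∀ T → s b (suc (H + T)) ≡ over (block + T)
    s≡over-block T = trans (s≡over (H + T)) (cong (λ z → over (z + T)) H≡block)

    beaten-by-start : over (block + t) ≤ over block → ⊥
    beaten-by-start ≤start = <⇒≱ (minimal (suc (H + 0)) (block-⊆-I b k r y b^k≤H block≤ (m^n>0 b (suc n))) H+0<H+t) (begin
      s b (suc (H + t))   ≡⟨ s≡over-block t ⟩
      over (block + t)    ≤⟨ ≤start ⟩
      over block          ≡⟨ cong over (+-identityʳ block) ⟨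
      over (block + 0)    ≡⟨ s≡over-block 0 ⟨
      s b (suc (H + 0))   ∎)
      where
      open ≤-Reasoning
      H+0<H+t : suc (H + 0) < suc (H + t)
      H+0<H+t = s≤s (subst (_≤ H + t) (+-suc H 0) (+-monoʳ-≤ H 1≤t))

    beaten-inside-block : ∃[ T ] T < b ^ suc n × over (block + t) < over (block + T) → ⊥
    beaten-inside-block (T , T<b^[1+n] , beaten) =
      <⇒≱ (subst₂ _<_ (sym (s≡over-block t)) (sym (s≡over-block T)) beaten)
          (maximal (suc (H + T)) (block-⊆-I b k r y b^k≤H block≤ T<b^[1+n]))

-- The exponents above position c, listed from the top down as e (λ' + c ∸ μ), μ < λ', are
-- pushed up by the minimality of λ', so their sum with b ^ k is a multiple of b ^ (n + 2).
module Gap (b : ℕ) (2≤b : 2 ≤ b) (k n λ' c : ℕ) (e : ℕ → ℕ)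
  (k-large : suc n + 2 * λ' + 1 < k)
  (minimal : ∀ μ → μ < λ' → ¬ (e (λ' + c ∸ μ) + 2 * μ + 1 ≤ suc n + 2 * λ'))
  where
  open Representations b 2≤b using (b-nonZero)
  open PowerSums b 2≤b

  r : ℕ
  r = suc n + 2 * λ'

  head : ℕ
  head = b ^ k + ∑[ μ < λ' ] b ^ e (λ' + c ∸ μ)

  S : ℕ → ℕ
  S y = ∑[ i < suc y ] b ^ (r ∸ 2 * i)

  2+n≤k : suc (suc n) ≤ k
  2+n≤k = <⇒≤ (≤-<-trans (≤-trans (≤-reflexive (+-comm 1 (suc n))) (+-monoˡ-≤ 1 (m≤m+n (suc n) (2 * λ')))) k-large)

  2+n≤r∸2μ : ∀ μ → μ < λ' → suc (suc n) ≤ r ∸ 2 * μ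
  2+n≤r∸2μ μ μ<λ = m+n≤o⇒m≤o∸n (suc (suc n)) (begin
    suc (suc n) + 2 * μ   ≡⟨ +-suc (suc n) (2 * μ) ⟨
    suc n + suc (2 * μ)   ≤⟨ +-monoʳ-≤ (suc n) (≤-trans (n≤1+n _) (≤-reflexive (sym (*-suc 2 μ)))) ⟩
    suc n + 2 * suc μ     ≤⟨ +-monoʳ-≤ (suc n) (*-monoʳ-≤ 2 μ<λ) ⟩
    r                     ∎)
    where open ≤-Reasoning

  r∸2μ≤exponent : ∀ μ → μ < λ' → r ∸ 2 * μ ≤ e (λ' + c ∸ μ)
  r∸2μ≤exponent μ μ<λ = m≤n+o⇒m∸n≤o r (2 * μ)
    (subst (r ≤_) (+-comm E (2 * μ)) (≤-pred (subst (r <_) (+-comm (E + 2 * μ) 1) (≰⇒> (minimal μ μ<λ)))))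
    where E = e (λ' + c ∸ μ)

  b^[2+n]∣b^k+∑ : ∀ (f : ℕ → ℕ) → (∀ μ → μ < λ' → suc (suc n) ≤ f μ) → b ^ suc (suc n) ∣ b ^ k + ∑[ μ < λ' ] b ^ f μ
  b^[2+n]∣b^k+∑ f large = ∣m∣n⇒∣m+n (^-∣ 2+n≤k) (∑-∣ λ' (λ μ → b ^ f μ) (λ μ μ<λ → ^-∣ (large μ μ<λ)))

  head-divisible : b ^ suc (suc n) ∣ head
  head-divisible = b^[2+n]∣b^k+∑ (λ μ → e (λ' + c ∸ μ)) (λ μ μ<λ → ≤-trans (2+n≤r∸2μ μ μ<λ) (r∸2μ≤exponent μ μ<λ))

  b^k+S≤head : ∀ y → y < λ' → b ^ k + S y ≤ head
  b^k+S≤head y y<λ = +-monoʳ-≤ (b ^ k) (begin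
    S y                                  ≤⟨ ∑-≤-longer (λ i → b ^ (r ∸ 2 * i)) y<λ ⟩
    ∑[ μ < λ' ] b ^ (r ∸ 2 * μ)          ≤⟨ ∑-mono-≤ λ' {λ μ → b ^ (r ∸ 2 * μ)} {λ μ → b ^ e (λ' + c ∸ μ)} (λ μ μ<λ → ^-monoʳ-≤ b (r∸2μ≤exponent μ μ<λ)) ⟩
    ∑[ μ < λ' ] b ^ e (λ' + c ∸ μ)       ∎)
    where open ≤-Reasoning

  head<⇒λ≤y : ∀ y → head < b ^ k + S y → λ' ≤ y
  head<⇒λ≤y y head< = ≮⇒≥ (λ y<λ → <⇒≱ head< (b^k+S≤head y y<λ))

  -- The bound b ^ k + S (λ' + d) is a multiple of b ^ (n + 2) plus a remainder in [b ^ (n + 1), b ^ (n + 2)).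
  boundHigh : ℕ
  boundHigh = b ^ k + ∑[ i < λ' ] b ^ (r ∸ 2 * i)

  boundLow : ℕ → ℕ
  boundLow d = ∑[ j < suc d ] b ^ (suc n ∸ 2 * j)

  bound-split : ∀ d → b ^ k + S (λ' + d) ≡ boundHigh + boundLow d
  bound-split d = begin
    b ^ k + ∑ (suc (λ' + d)) g                              ≡⟨ cong (λ m → b ^ k + ∑ m g) (+-suc λ' d) ⟨
    b ^ k + ∑ (λ' + suc d) g                                ≡⟨ cong (b ^ k +_) (∑-++ λ' (suc d) g) ⟩
    b ^ k + (∑[ i < λ' ] g i + ∑[ j < suc d ] g (λ' + j))   ≡⟨ +-assoc (b ^ k) _ _ ⟨
    boundHigh + ∑[ j < suc d ] g (λ' + j)                   ≡⟨ cong (boundHigh +_) (∑-cong (suc d) (λ j → cong (b ^_) (index j))) ⟩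
    boundHigh + boundLow d                                  ∎
    where
    open ≡-Reasoning
    g : ℕ → ℕ
    g i = b ^ (r ∸ 2 * i)
    index : ∀ j → r ∸ 2 * (λ' + j) ≡ suc n ∸ 2 * j
    index j = trans (cong₂ _∸_ (+-comm (suc n) (2 * λ')) (*-distribˡ-+ 2 λ' j)) ([m+n]∸[m+o]≡n∸o (2 * λ') (suc n) (2 * j))

  head-block : ∀ y → 2 * y < r → head < b ^ k + S y → head + b ^ suc n ≤ b ^ k + S y
  head-block y 2y<r head< with m≤n⇒∃[o]m+o≡n (head<⇒λ≤y y head<)
  ... | d , refl = begin
    head + b ^ suc n        ≤⟨ +-mono-≤ head≤boundHigh (m≤m+n (b ^ suc n) _) ⟩
    boundHigh + boundLow d  ≡⟨ bound-split d ⟨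
    b ^ k + S (λ' + d)      ∎
    where
    open ≤-Reasoning
    2d≤1+n : 2 * d ≤ suc n
    2d≤1+n = <⇒≤ (+-cancelˡ-< (2 * λ') (2 * d) (suc n)
      (subst₂ _<_ (*-distribˡ-+ 2 λ' d) (+-comm (suc n) (2 * λ')) 2y<r))
    head≤boundHigh : head ≤ boundHigh
    head≤boundHigh = multiple-<⇒≤ head-divisible (b^[2+n]∣b^k+∑ (λ i → r ∸ 2 * i) 2+n≤r∸2μ) (begin-strict
      head                         <⟨ head< ⟩
      b ^ k + S (λ' + d)           ≡⟨ bound-split d ⟩
      boundHigh + boundLow d       <⟨ +-monoʳ-< boundHigh (∑-alternate-powers-< d (suc n) 2d≤1+n) ⟩
      boundHigh + b ^ suc (suc n)  ∎)

top-index : ∀ {λ' ℓ} → λ' + 1 ≤ ℓ → ∃[ c ] ℓ ≡ suc (λ' + c)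
top-index {λ'} λ+1≤ℓ with m≤n⇒∃[o]m+o≡n λ+1≤ℓ
... | c , refl = c , cong (_+ c) (+-comm λ' 1)

gap-witness : ∀ {E L r} → E + 2 * L + 1 < r → ∃[ n ] r ≡ suc n + 2 * L × E < n
gap-witness {E} {L} gap with m≤n⇒∃[o]m+o≡n gap
... | o , refl = suc (E + o) , regroup E L o , s≤s (m≤m+n E o)
  where
  regroup : ∀ E L o → suc (E + 2 * L + 1) + o ≡ suc (suc (E + o)) + 2 * L
  regroup = solve-∀

no-gap : (b k r y : ℕ) → 2 ≤ b → 2 * y < r → r + 1 < k →
    (ν : ℕ) → IsNu b k r y ν →
    (ℓ : ℕ) (e : ℕ → ℕ) →
    (∀ i j → i < j → j ≤ ℓ → e i < e j) → e ℓ ≡ k →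
    ν ∸ 1 ≡ sum (map (λ i → b ^ e i) (upTo (suc ℓ))) →
    (λ' : ℕ) → λ' + 1 ≤ ℓ →
    (∀ μ → μ < λ' → ¬ (e (ℓ ∸ 1 ∸ μ) + 2 * μ + 1 ≤ r)) →
    ¬ (e (ℓ ∸ 1 ∸ λ') + 2 * λ' + 1 < r)
no-gap b k r y 2≤b 2y<r k-large ν isNu ℓ e increasing e-top expansion λ' λ+1≤ℓ minimal gap
  with top-index λ+1≤ℓ
... | c , refl with gap-witness {e c} {λ'} (subst (λ i → e i + 2 * λ' + 1 < r) (m+n∸m≡n λ' c) gap)
...   | n , refl , ec<n =
  binary-tail-⊥ {k} {r} {y} n isNu ν≡ tail-binary 1≤t head-divisible (m≤m+n (b ^ k) _)
    (subst (λ z → head + b ^ suc n ≤ b ^ k + z) (sym S≡) (head-block y 2y<r head<))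
  where
  open Representations b 2≤b
  open PowerSums b 2≤b
  open Nu b 2≤b
  open Gap b 2≤b k n λ' c e k-large minimal hiding (r)
  f : ℕ → ℕ
  f i = b ^ e i
  t = ∑[ i < suc c ] f i
  ν∸1≡ : ν ∸ 1 ≡ head + t
  ν∸1≡ = begin
    ν ∸ 1                                                        ≡⟨ expansion ⟩
    sum (map f (upTo (suc (suc (λ' + c)))))                      ≡⟨ sum-map-upTo (suc (suc (λ' + c))) f ⟩
    ∑ (suc (suc (λ' + c))) f                                     ≡⟨ ∑-split-reversed λ' c f ⟩
    t + (f (suc (λ' + c)) + ∑[ μ < λ' ] f (λ' + c ∸ μ))          ≡⟨ cong (λ z → t + (b ^ z + _)) e-top ⟩
    t + head                                                     ≡⟨ +-comm t head ⟩
    head + t                                                     ∎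
    where open ≡-Reasoning
  S≡ : sum (map (λ i → b ^ (r ∸ 2 * i)) (upTo (suc y))) ≡ S y
  S≡ = sum-map-upTo (suc y) (λ i → b ^ (r ∸ 2 * i))
  ν>0 : 0 < ν
  ν>0 = ≤-<-trans z≤n (proj₁ (proj₁ isNu))
  ν≡ : ν ≡ suc (head + t)
  ν≡ = trans (sym (suc-pred ν {{>-nonZero ν>0}})) (cong suc ν∸1≡)
  head< : head < b ^ k + S y
  head< = begin-strict
    head                                                      ≤⟨ m≤m+n head t ⟩
    head + t                                                  <⟨ ≤-reflexive (sym ν≡) ⟩
    ν                                                         ≤⟨ proj₂ (proj₁ isNu) ⟩
    b ^ k + sum (map (λ i → b ^ (r ∸ 2 * i)) (upTo (suc y)))  ≡⟨ cong (b ^ k +_) S≡ ⟩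
    b ^ k + S y                                               ∎
    where open ≤-Reasoning
  tail-binary : Binary n t
  tail-binary = binary-∑-powers c e
    (λ i i<c → increasing i (suc i) (n<1+n i) (≤-trans i<c (≤-trans (m≤n+m c λ') (n≤1+n _)))) ec<n
  1≤t : 1 ≤ t
  1≤t = ≤-trans (m^n>0 b (e 0)) (m≤m+n (f 0) _)

lemma18 : (b k r y : ℕ) → 2 ≤ b → 2 * y < r → r + 1 < k →
    (ν : ℕ) → IsNu b k r y ν →
    (ℓ : ℕ) (e : ℕ → ℕ) →
    (∀ i j → i < j → j ≤ ℓ → e i < e j) → e ℓ ≡ k →
    ν ∸ 1 ≡ sum (map (λ i → b ^ e i) (upTo (suc ℓ))) →
    (λ' : ℕ) → λ' + 1 ≤ ℓ →
    e (ℓ ∸ 1 ∸ λ') + 2 * λ' + 1 ≤ r →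
    (∀ μ → μ < λ' → ¬ (e (ℓ ∸ 1 ∸ μ) + 2 * μ + 1 ≤ r)) →
    e (ℓ ∸ 1 ∸ λ') + 2 * λ' + 1 ≡ r
lemma18 b k r y 2≤b 2y<r k-large ν isNu ℓ e increasing e-top expansion λ' λ+1≤ℓ ≤r minimal =
  ≤-antisym ≤r (≮⇒≥ (no-gap b k r y 2≤b 2y<r k-large ν isNu ℓ e increasing e-top expansion λ' λ+1≤ℓ minimal))
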